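{- Let $k\ge 2$, $n\ge 1$ and $w=w_1\dots w_n\in S_n$. Then the stable configuration $\mathcal{C}_{k,n,w}=(\pi_1,\dots,\pi_{k^n})$ contains the pattern $w$: there exist positions $p_1<p_2<\dots<p_n$ such that for all $a,b\in[n]$, $\pi_{p_a}<\pi_{p_b}$ if and only if $w_a<w_b$.
   Context: The infinite rooted directed $k$-ary tree has a root on layer $1$; every vertex has $k$ children, ordered left to right, on the next layer. A vertex with at least $k$ chips may fire by choosing $k$ of its labeled chips and sending the $j$th smallest to its $j$th leftmost child. Chips $0,\dots,k^n-1$ start at the root and are written in $n$-digit $k$-ary expansion (leading zeros allowed). For $w\in S_n$, the strategy $F_w$ fires, for each $i\in[n]$, each vertex $v$ on layer $i$ so that all chips on $v$ whose $w_i$th most significant digit equals $j$ go to the $(j+1)$th leftmost child of $v$ ($j=0,\dots,k-1$). $\mathcal{C}_{k,n,w}$ denotes the resulting stable configuration, written as the sequence of chips on layer $n+1$ read left to right. -}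

module Defs where

open import Data.Nat using (ℕ; zero; suc; _^_; _∸_; _≟_)
open import Data.Nat.DivMod using (_/_; _%_)
open import Data.Nat.Properties using (m^n≢0)
open import Data.Fin using (Fin; toℕ)
open import Data.Fin.Permutation using (Permutation′; _⟨$⟩ʳ_)
open import Data.List using (List; []; _∷_; map; concat; concatMap; filter; upTo; allFin; foldl)

-- The d-th most significant digit (d 0-based, so d = w_i - 1) of chip c
-- in its n-digit base-k expansion (leading zeros allowed).
-- Only used for k ≥ 2; for k = 0 we return 0 (irrelevant).
digit : (k n : ℕ) → ℕ → ℕ → ℕ
digit zero    n d c = 0
digit (suc m) n d c = _/_ c (suc m ^ (n ∸ suc d)) {{m^n≢0 (suc m) (n ∸ suc d)}} % suc m

-- A configuration on a layer: the list of vertices, left to right,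
-- each given by the list of chips it holds.
Layer : Set
Layer = List (List ℕ)

fireLayer : (k n d : ℕ) → Layer → Layer
fireLayer k n d = concatMap (λ L → map (λ j → filter (λ c → digit k n d c ≟ j) L) (upTo k))

rootLayer : (k n : ℕ) → Layer
rootLayer k n = (upTo (k ^ n)) ∷ []

-- Strategy F_w: for i = 1, …, n fire layer i using the w_i-th most
-- significant digit; then read the chips on layer n+1 left to right.
stableConfig : (k n : ℕ) → Permutation′ n → List ℕ
stableConfig k n w =
  concat (foldl (λ vs i → fireLayer k n (toℕ (w ⟨$⟩ʳ i)) vs) (rootLayer k n) (allFin n))

{-# OPTIONS --safe #-}
module Submission where

-- Firing layer i by digit w_i sends a chip to the child indexed by that digit, so the q-th
-- vertex of layer n+1 holds exactly the chip c < k^n whose digit w_j equals the j-th digit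
-- of q for every j: the stable configuration lists q ↦ (q with its digits permuted by w⁻¹).
-- Let e_d be the number whose n digits are all 1 except a 0 in position d. Then d ↦ e_d is
-- increasing and the digit permutation sends e_a to e_{w_a}, so the entries at the positions
-- e_1 < … < e_n of the stable configuration are e_{w_1}, …, e_{w_n}, an occurrence of w.

open import Defs
open import Data.Bool using (true; false; if_then_else_)
open import Data.Empty using (⊥-elim)
open import Data.Fin as F using (Fin; toℕ; fromℕ<)
open import Data.Fin.Properties as FP using (toℕ<n; toℕ-fromℕ<)
open import Data.Fin.Permutation using (Permutation′; _⟨$⟩ʳ_; _⟨$⟩ˡ_; inverseˡ; inverseʳ)
open import Data.List
  using (List; []; _∷_; [_]; _++_; length; lookup; map; concat; filter; foldl; applyUpTo; upTo; tabulate; allFin)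
open import Data.List.Properties
open import Data.List.Membership.Propositional using (_∈_)
open import Data.List.Membership.Propositional.Properties
  using (∈-filter⁺; ∈-filter⁻; ∈-upTo⁺; ∈-upTo⁻)
import Data.List.Relation.Unary.All as All
import Data.List.Relation.Unary.AllPairs as AllPairs
open import Data.List.Relation.Unary.Any using (here; there)
open import Data.List.Relation.Unary.Unique.Propositional using (Unique)
import Data.List.Relation.Unary.Unique.Propositional.Properties as Unique
open import Data.Nat using (ℕ; zero; suc; _+_; _*_; _^_; _∸_; _≤_; _<_; _≟_; z<s; s<s; NonZero)
open import Data.Nat.DivMod
open import Data.Nat.Divisibility using (_∣_; divides)
open import Data.Nat.Properties
open import Data.Product using (Σ; _×_; _,_; proj₁; proj₂)
open import Function using (_∘_; id)
open import Function.Bundles using (_⇔_; mk⇔; Equivalence)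
open import Relation.Binary.Definitions using (tri<; tri≈; tri>)
open import Relation.Binary.PropositionalEquality hiding ([_])
open import Relation.Nullary using (yes; no; does)
open import Relation.Nullary.Decidable using (dec-true; dec-false)
open import Relation.Unary using (Decidable)

private
  variable
    A : Set

applyUpTo-cong-< : ∀ {f g : ℕ → A} m → (∀ {i} → i < m → f i ≡ g i) →
                   applyUpTo f m ≡ applyUpTo g m
applyUpTo-cong-< zero    f≡g = refl
applyUpTo-cong-< (suc m) f≡g = cong₂ _∷_ (f≡g z<s) (applyUpTo-cong-< m (f≡g ∘ s<s))

applyUpTo-+ : ∀ (f : ℕ → A) m n →
              applyUpTo f (m + n) ≡ applyUpTo f m ++ applyUpTo (λ i → f (m + i)) n
applyUpTo-+ f zero    n = refl
applyUpTo-+ f (suc m) n = cong (f 0 ∷_) (applyUpTo-+ (f ∘ suc) m n)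

concat-applyUpTo-* : ∀ (f : ℕ → A) m n →
  concat (applyUpTo (λ q → applyUpTo (λ j → f (q * n + j)) n) m) ≡ applyUpTo f (m * n)
concat-applyUpTo-* f zero    n = refl
concat-applyUpTo-* f (suc m) n = begin
    concat (applyUpTo block (suc m))
  ≡⟨ cong concat (applyUpTo-∷ʳ block m) ⟨
    concat (applyUpTo block m ++ [ block m ])
  ≡⟨ concat-++ (applyUpTo block m) [ block m ] ⟨
    concat (applyUpTo block m) ++ block m ++ []
  ≡⟨ cong₂ _++_ (concat-applyUpTo-* f m n) (++-identityʳ (block m)) ⟩
    applyUpTo f (m * n) ++ block m
  ≡⟨ applyUpTo-+ f (m * n) n ⟨
    applyUpTo f (m * n + n)
  ≡⟨ cong (applyUpTo f) (+-comm (m * n) n) ⟩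
    applyUpTo f (suc m * n) ∎
  where
  open ≡-Reasoning
  block : ℕ → List _
  block q = applyUpTo (λ j → f (q * n + j)) n

module _ {P Q R : A → Set} (P? : Decidable P) (Q? : Decidable Q) (R? : Decidable R) where

  filter-filter : (∀ x → R x ⇔ (P x × Q x)) → ∀ xs → filter Q? (filter P? xs) ≡ filter R? xs
  filter-filter R⇔P×Q []       = refl
  filter-filter R⇔P×Q (x ∷ xs) with P? x | R? x
  ... | yes _  | yes rx =
    trans (filter-accept Q? (proj₂ (to rx))) (cong (x ∷_) (filter-filter R⇔P×Q xs))
    where open Equivalence (R⇔P×Q x)
  ... | yes px | no ¬rx =
    trans (filter-reject Q? (λ qx → ¬rx (from (px , qx)))) (filter-filter R⇔P×Q xs)
    where open Equivalence (R⇔P×Q x)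
  ... | no ¬px | yes rx = ⊥-elim (¬px (proj₁ (to rx)))
    where open Equivalence (R⇔P×Q x)
  ... | no _   | no _   = filter-filter R⇔P×Q xs

Unique⇒≡[x] : ∀ {x : A} {xs} → Unique xs → x ∈ xs → (∀ {y} → y ∈ xs → y ≡ x) →
              xs ≡ [ x ]
Unique⇒≡[x] {xs = y ∷ []}     _                              _ ≡x = cong [_] (≡x (here refl))
Unique⇒≡[x] {xs = y ∷ z ∷ xs} ((y≢z All.∷ _) AllPairs.∷ _) _ ≡x =
  ⊥-elim (y≢z (trans (≡x (here refl)) (sym (≡x (there (here refl))))))

filter-fibre-upTo : ∀ (f g : ℕ → ℕ) {m q} →
                    (∀ {c} → c < m → g (f c) ≡ c) → g q < m → f (g q) ≡ q →
                    filter (λ c → f c ≟ q) (upTo m) ≡ [ g q ]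
filter-fibre-upTo f g {m} {q} g∘f≗id gq<m f[gq]≡q =
  Unique⇒≡[x] (Unique.filter⁺ (λ c → f c ≟ q) (Unique.upTo⁺ m))
    (∈-filter⁺ (λ c → f c ≟ q) (∈-upTo⁺ gq<m) f[gq]≡q)
    (λ y∈fibre → let y∈upTo , fy≡q = ∈-filter⁻ (λ c → f c ≟ q) y∈fibre
                 in trans (sym (g∘f≗id (∈-upTo⁻ y∈upTo))) (cong g fy≡q))

m*o+p<n*o : ∀ {m n o p} → m < n → p < o → m * o + p < n * o
m*o+p<n*o {m} {n} {o} {p} m<n p<o = begin-strict
    m * o + p  <⟨ +-monoʳ-< (m * o) p<o ⟩
    m * o + o  ≡⟨ +-comm (m * o) o ⟩
    suc m * o  ≤⟨ *-monoˡ-≤ o m<n ⟩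
    n * o      ∎
  where open ≤-Reasoning

[m*n+o]%n≡o : ∀ m {n o} .{{_ : NonZero n}} → o < n → (m * n + o) % n ≡ o
[m*n+o]%n≡o m {n} {o} o<n = begin
    (m * n + o) % n  ≡⟨ cong (_% n) (+-comm (m * n) o) ⟩
    (o + m * n) % n  ≡⟨ [m+kn]%n≡m%n o m n ⟩
    o % n            ≡⟨ m<n⇒m%n≡m o<n ⟩
    o                ∎
  where open ≡-Reasoning

[m*n+o]/n≡m : ∀ m {n o} .{{_ : NonZero n}} → o < n → (m * n + o) / n ≡ m
[m*n+o]/n≡m m {n} {o} o<n = begin
    (m * n + o) / n    ≡⟨ +-distrib-/-∣ˡ o (divides m refl) ⟩
    m * n / n + o / n  ≡⟨ cong₂ _+_ (m*n/n≡m m n) (m<n⇒m/n≡0 o<n) ⟩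
    m + 0              ≡⟨ +-identityʳ m ⟩
    m                  ∎
  where open ≡-Reasoning

*+-injective : ∀ {m m′ n o o′} .{{_ : NonZero n}} → o < n → o′ < n →
               m * n + o ≡ m′ * n + o′ → m ≡ m′ × o ≡ o′
*+-injective {m} {m′} o<n o′<n eq =
  trans (sym ([m*n+o]/n≡m m o<n)) (trans (cong (_/ _) eq) ([m*n+o]/n≡m m′ o′<n)) ,
  trans (sym ([m*n+o]%n≡o m o<n)) (trans (cong (_% _) eq) ([m*n+o]%n≡o m′ o′<n))

_containsPattern_ : ∀ {n} → List ℕ → Permutation′ n → Set
_containsPattern_ {n} xs w = Σ (Fin n → Fin (length xs)) λ p →
  (∀ a b → a F.< b → p a F.< p b) ×
  (∀ a b → (lookup xs (p a) < lookup xs (p b)) ⇔ ((w ⟨$⟩ʳ a) F.< (w ⟨$⟩ʳ b)))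

strictMono⇒<⇔< : ∀ {n} {e : Fin n → ℕ} → (∀ {a b} → a F.< b → e a < e b) →
                 ∀ a b → (e a < e b) ⇔ (a F.< b)
strictMono⇒<⇔< {e = e} e-mono a b = mk⇔ reflect e-mono
  where
  reflect : e a < e b → a F.< b
  reflect ea<eb with FP.<-cmp a b
  ... | tri< a<b _ _  = a<b
  ... | tri≈ _ refl _ = ⊥-elim (<-irrefl refl ea<eb)
  ... | tri> _ _ b<a  = ⊥-elim (<-asym ea<eb (e-mono b<a))

applyUpTo-containsPattern : ∀ {n m} (w : Permutation′ n) (σ : ℕ → ℕ) (e : Fin n → ℕ) →
  (∀ {a b} → a F.< b → e a < e b) → (∀ a → e a < m) → (∀ a → σ (e a) ≡ e (w ⟨$⟩ʳ a)) →
  applyUpTo σ m containsPattern w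
applyUpTo-containsPattern {n} {m} w σ e e-mono e<m σ∘e≗e∘w = p , p-mono , p-pattern
  where
  xs = applyUpTo σ m
  e<length : ∀ a → e a < length xs
  e<length a = subst (e a <_) (sym (length-applyUpTo σ m)) (e<m a)
  p : Fin n → Fin (length xs)
  p a = fromℕ< (e<length a)
  toℕ-p : ∀ a → toℕ (p a) ≡ e a
  toℕ-p a = toℕ-fromℕ< (e<length a)
  lookup-p : ∀ a → lookup xs (p a) ≡ e (w ⟨$⟩ʳ a)
  lookup-p a = trans (lookup-applyUpTo σ m (p a)) (trans (cong σ (toℕ-p a)) (σ∘e≗e∘w a))
  p-mono : ∀ a b → a F.< b → p a F.< p b
  p-mono a b a<b = subst₂ _<_ (sym (toℕ-p a)) (sym (toℕ-p b)) (e-mono a<b)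
  p-pattern : ∀ a b → (lookup xs (p a) < lookup xs (p b)) ⇔ ((w ⟨$⟩ʳ a) F.< (w ⟨$⟩ʳ b))
  p-pattern a b = subst₂ (λ x y → (x < y) ⇔ _) (sym (lookup-p a)) (sym (lookup-p b))
    (strictMono⇒<⇔< e-mono (w ⟨$⟩ʳ a) (w ⟨$⟩ʳ b))

onesExcept : ∀ {n} → Fin n → Fin n → ℕ
onesExcept d j = if does (j F.≟ d) then 0 else 1

onesExcept-self : ∀ {n} (d : Fin n) → onesExcept d d ≡ 0
onesExcept-self d = cong (λ b → if b then 0 else 1) (dec-true (d F.≟ d) refl)

onesExcept-≢ : ∀ {n} {d j : Fin n} → j ≢ d → onesExcept d j ≡ 1
onesExcept-≢ {d = d} {j} j≢d = cong (λ b → if b then 0 else 1) (dec-false (j F.≟ d) j≢d)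

onesExcept-permute : ∀ {n} (π : Permutation′ n) a j →
                     onesExcept a (π ⟨$⟩ˡ j) ≡ onesExcept (π ⟨$⟩ʳ a) j
onesExcept-permute π a j with j F.≟ π ⟨$⟩ʳ a
... | yes refl  = trans (cong (onesExcept a) (inverseˡ π)) (onesExcept-self a)
... | no j≢π[a] =
  onesExcept-≢ (λ π⁻¹[j]≡a → j≢π[a] (trans (sym (inverseʳ π)) (cong (π ⟨$⟩ʳ_) π⁻¹[j]≡a)))

module _ (k′ : ℕ) where
  private
    k : ℕ
    k = suc k′

  fromDigits : ∀ {n} → (Fin n → ℕ) → ℕ
  fromDigits {zero}  t = 0
  fromDigits {suc n} t = t F.zero * k ^ n + fromDigits (t ∘ F.suc)

  fromDigits-cong : ∀ {n} {t u : Fin n → ℕ} → (∀ j → t j ≡ u j) → fromDigits t ≡ fromDigits u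
  fromDigits-cong {zero}  t≡u = refl
  fromDigits-cong {suc n} t≡u =
    cong₂ (λ a b → a * k ^ n + b) (t≡u F.zero) (fromDigits-cong (t≡u ∘ F.suc))

  fromDigits-< : ∀ {n} {t : Fin n → ℕ} → (∀ j → t j < k) → fromDigits t < k ^ n
  fromDigits-< {zero}  t<k = z<s
  fromDigits-< {suc n} t<k = m*o+p<n*o (t<k F.zero) (fromDigits-< (t<k ∘ F.suc))

  fromDigits-<-lex : ∀ {n} {t u : Fin n → ℕ} → (∀ j → t j < k) → (d : Fin n) →
                     (∀ j → j F.< d → t j ≡ u j) → t d < u d → fromDigits t < fromDigits u
  fromDigits-<-lex {suc n} {t} t<k F.zero _ td<ud =
    ≤-trans (m*o+p<n*o td<ud (fromDigits-< (t<k ∘ F.suc))) (m≤m+n _ _)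
  fromDigits-<-lex {suc n} {t} {u} t<k (F.suc d) t≡u td<ud =
    subst (λ a → t F.zero * k ^ n + fromDigits (t ∘ F.suc) < a * k ^ n + fromDigits (u ∘ F.suc))
      (t≡u F.zero z<s)
      (+-monoʳ-< (t F.zero * k ^ n)
        (fromDigits-<-lex (t<k ∘ F.suc) d (λ j → t≡u (F.suc j) ∘ s<s) td<ud))

  foldl-horner-tabulate : ∀ {m} (t : A → ℕ) (h : Fin m → A) a →
                          foldl (λ b x → b * k + t x) a (tabulate h) ≡ a * k ^ m + fromDigits (t ∘ h)
  foldl-horner-tabulate {m = zero}  t h a = sym (trans (+-identityʳ (a * 1)) (*-identityʳ a))
  foldl-horner-tabulate {m = suc m} t h a = begin
      foldl (λ b x → b * k + t x) (a * k + t (h F.zero)) (tabulate (h ∘ F.suc))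
    ≡⟨ foldl-horner-tabulate t (h ∘ F.suc) (a * k + t (h F.zero)) ⟩
      (a * k + t (h F.zero)) * k ^ m + lower
    ≡⟨ cong (_+ lower) (*-distribʳ-+ (k ^ m) (a * k) (t (h F.zero))) ⟩
      a * k * k ^ m + t (h F.zero) * k ^ m + lower
    ≡⟨ +-assoc (a * k * k ^ m) _ _ ⟩
      a * k * k ^ m + (t (h F.zero) * k ^ m + lower)
    ≡⟨ cong (_+ (t (h F.zero) * k ^ m + lower)) (*-assoc a k (k ^ m)) ⟩
      a * k ^ suc m + fromDigits (t ∘ h) ∎
    where
    open ≡-Reasoning
    lower = fromDigits (t ∘ h ∘ F.suc)

  digit-< : ∀ n d c → digit k n d c < k
  digit-< n d c = m%n<n (c / k ^ (n ∸ suc d)) k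
    where instance _ = m^n≢0 k (n ∸ suc d)

  module _ (n : ℕ) where
    private instance
      k^n≢0 : NonZero (k ^ n)
      k^n≢0 = m^n≢0 k n

    digit-% : ∀ {d} c → d < n → digit k n d (c % k ^ n) ≡ digit k n d c
    digit-% {d} c d<n = begin
        c % k ^ n / k ^ e % k          ≡⟨ m%[n*o]/o≡m/o%n (c % k ^ n) k (k ^ e) ⟨
        c % k ^ n % k ^ suc e / k ^ e  ≡⟨ cong (λ x → _/_ x (k ^ e) {{m^n≢0 k e}})
                                               (m∣n⇒o%n%m≡o%m (k ^ suc e) (k ^ n) c k^[1+e]∣k^n) ⟩
        c % k ^ suc e / k ^ e          ≡⟨ m%[n*o]/o≡m/o%n c k (k ^ e) ⟩
        c / k ^ e % k                  ∎
      where
      open ≡-Reasoning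
      e = n ∸ suc d
      instance
        _ = m^n≢0 k e
        _ = m^n≢0 k (suc e)
      k^[1+e]∣k^n : k ^ suc e ∣ k ^ n
      k^[1+e]∣k^n = divides (k ^ d) (begin
        k ^ n              ≡⟨ cong (k ^_) (trans (+-suc d e) (m+[n∸m]≡n d<n)) ⟨
        k ^ (d + suc e)    ≡⟨ ^-distribˡ-+-* k d (suc e) ⟩
        k ^ d * k ^ suc e  ∎)

  digits : ∀ n → ℕ → Fin n → ℕ
  digits n c d = digit k n (toℕ d) c

  digits-< : ∀ n c j → digits n c j < k
  digits-< n c j = digit-< n (toℕ j) c

  digits-fromDigits : ∀ {n} {t : Fin n → ℕ} → (∀ j → t j < k) →
                      ∀ d → digits n (fromDigits t) d ≡ t d
  digits-fromDigits {suc n} {t} t<k F.zero = begin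
      (t F.zero * k ^ n + fromDigits (t ∘ F.suc)) / k ^ n % k
    ≡⟨ cong (_% k) ([m*n+o]/n≡m (t F.zero) (fromDigits-< (t<k ∘ F.suc))) ⟩
      t F.zero % k
    ≡⟨ m<n⇒m%n≡m (t<k F.zero) ⟩
      t F.zero ∎
    where
    open ≡-Reasoning
    instance _ = m^n≢0 k n
  digits-fromDigits {suc n} {t} t<k (F.suc d) = begin
      digits n (fromDigits t) d
    ≡⟨ digit-% n (fromDigits t) (toℕ<n d) ⟨
      digits n (fromDigits t % k ^ n) d
    ≡⟨ cong (λ c → digits n c d) ([m*n+o]%n≡o (t F.zero) (fromDigits-< (t<k ∘ F.suc))) ⟩
      digits n (fromDigits (t ∘ F.suc)) d
    ≡⟨ digits-fromDigits (t<k ∘ F.suc) d ⟩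
      t (F.suc d) ∎
    where
    open ≡-Reasoning
    instance _ = m^n≢0 k n

  fromDigits-digits : ∀ n {c} → c < k ^ n → fromDigits (digits n c) ≡ c
  fromDigits-digits zero        c<1   = sym (n<1⇒n≡0 c<1)
  fromDigits-digits (suc n) {c} c<k^n = begin
      c / k ^ n % k * k ^ n + fromDigits (digits n c)
    ≡⟨ cong₂ (λ a b → a * k ^ n + b) (m<n⇒m%n≡m (m<n*o⇒m/o<n c<k^n)) lower ⟩
      c / k ^ n * k ^ n + c % k ^ n
    ≡⟨ +-comm _ (c % k ^ n) ⟩
      c % k ^ n + c / k ^ n * k ^ n
    ≡⟨ m≡m%n+[m/n]*n c (k ^ n) ⟨
      c ∎
    where
    open ≡-Reasoning
    instance _ = m^n≢0 k n
    lower : fromDigits (digits n c) ≡ c % k ^ n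
    lower = trans (fromDigits-cong (λ d → sym (digit-% n c (toℕ<n d))))
                  (fromDigits-digits n (m%n<n c (k ^ n)))

  permuteDigits : ∀ {n} → (Fin n → Fin n) → ℕ → ℕ
  permuteDigits {n} π c = fromDigits (digits n c ∘ π)

  permuteDigits-< : ∀ {n} (π : Fin n → Fin n) c → permuteDigits π c < k ^ n
  permuteDigits-< {n} π c = fromDigits-< (digits-< n c ∘ π)

  permuteDigits-fromDigits : ∀ {n} (π : Fin n → Fin n) {t : Fin n → ℕ} → (∀ j → t j < k) →
                             permuteDigits π (fromDigits t) ≡ fromDigits (t ∘ π)
  permuteDigits-fromDigits π t<k = fromDigits-cong (digits-fromDigits t<k ∘ π)

  permuteDigits-inverse : ∀ {n} (π ρ : Fin n → Fin n) → (∀ j → ρ (π j) ≡ j) →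
                          ∀ {c} → c < k ^ n → permuteDigits π (permuteDigits ρ c) ≡ c
  permuteDigits-inverse {n} π ρ ρ∘π≗id {c} c<k^n = begin
      permuteDigits π (permuteDigits ρ c)  ≡⟨ permuteDigits-fromDigits π (digits-< n c ∘ ρ) ⟩
      fromDigits (digits n c ∘ ρ ∘ π)      ≡⟨ fromDigits-cong (cong (digits n c) ∘ ρ∘π≗id) ⟩
      fromDigits (digits n c)              ≡⟨ fromDigits-digits n c<k^n ⟩
      c                                    ∎
    where open ≡-Reasoning

  -- ds lists the digit positions fired so far, most recent first; vertex q of the layer,
  -- counted from the left, holds the chips whose fired digits spell q in base k.
  module _ (n : ℕ) where
    address : List ℕ → ℕ → ℕ
    address []       c = 0
    address (d ∷ ds) c = address ds c * k + digit k n d c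

    vertex : List ℕ → ℕ → List ℕ
    vertex ds q = filter (λ c → address ds c ≟ q) (upTo (k ^ n))

    layer : List ℕ → Layer
    layer ds = applyUpTo (vertex ds) (k ^ length ds)

    rootLayer≡layer[] : rootLayer k n ≡ layer []
    rootLayer≡layer[] = cong [_] (sym (filter-all (λ c → 0 ≟ 0) (All.universal (λ _ → refl) _)))

    children-vertex : ∀ d ds q →
      map (λ j → filter (λ c → digit k n d c ≟ j) (vertex ds q)) (upTo k) ≡
      applyUpTo (λ j → vertex (d ∷ ds) (q * k + j)) k
    children-vertex d ds q = trans (map-upTo _ k) (applyUpTo-cong-< k λ j<k →
      filter-filter (λ c → address ds c ≟ q) (λ c → digit k n d c ≟ _)
                    (λ c → address (d ∷ ds) c ≟ _)
        (λ c → mk⇔ (*+-injective (digit-< n d c) j<k) λ { (refl , refl) → refl })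
        (upTo (k ^ n)))

    fireLayer-layer : ∀ d ds → fireLayer k n d (layer ds) ≡ layer (d ∷ ds)
    fireLayer-layer d ds = begin
        concat (map children (applyUpTo (vertex ds) m))
      ≡⟨ cong concat (map-applyUpTo (vertex ds) children m) ⟩
        concat (applyUpTo (children ∘ vertex ds) m)
      ≡⟨ cong concat (applyUpTo-cong-< m (λ {q} _ → children-vertex d ds q)) ⟩
        concat (applyUpTo (λ q → applyUpTo (λ j → vertex (d ∷ ds) (q * k + j)) k) m)
      ≡⟨ concat-applyUpTo-* (vertex (d ∷ ds)) m k ⟩
        applyUpTo (vertex (d ∷ ds)) (m * k)
      ≡⟨ cong (applyUpTo (vertex (d ∷ ds))) (*-comm m k) ⟩
        layer (d ∷ ds) ∎
      where
      open ≡-Reasoning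
      m = k ^ length ds
      children : List ℕ → Layer
      children V = map (λ j → filter (λ c → digit k n d c ≟ j) V) (upTo k)

    module _ (f : A → ℕ) where
      push : List ℕ → A → List ℕ
      push ds i = f i ∷ ds

      foldl-fireLayer : ∀ ds xs →
        foldl (λ L i → fireLayer k n (f i) L) (layer ds) xs ≡ layer (foldl push ds xs)
      foldl-fireLayer ds []       = refl
      foldl-fireLayer ds (i ∷ xs) =
        trans (cong (λ L → foldl (λ L i → fireLayer k n (f i) L) L xs) (fireLayer-layer (f i) ds))
              (foldl-fireLayer (f i ∷ ds) xs)

      length-foldl-push : ∀ ds xs → length (foldl push ds xs) ≡ length xs + length ds
      length-foldl-push ds []       = refl
      length-foldl-push ds (i ∷ xs) =
        trans (length-foldl-push (f i ∷ ds) xs) (+-suc (length xs) (length ds))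

      address-foldl-push : ∀ ds xs c →
        address (foldl push ds xs) c ≡ foldl (λ a i → a * k + digit k n (f i) c) (address ds c) xs
      address-foldl-push ds []       c = refl
      address-foldl-push ds (i ∷ xs) c = address-foldl-push (f i ∷ ds) xs c

  stableConfig≡applyUpTo-permuteDigits : ∀ n (w : Permutation′ n) →
    stableConfig k n w ≡ applyUpTo (permuteDigits (w ⟨$⟩ˡ_)) (k ^ n)
  stableConfig≡applyUpTo-permuteDigits n w = begin
      concat (foldl fire (rootLayer k n) (allFin n))
    ≡⟨ cong (λ L → concat (foldl fire L (allFin n))) (rootLayer≡layer[] n) ⟩
      concat (foldl fire (layer n []) (allFin n))
    ≡⟨ cong concat (foldl-fireLayer n f [] (allFin n)) ⟩
      concat (applyUpTo (vertex n ds) (k ^ length ds))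
    ≡⟨ cong (λ m → concat (applyUpTo (vertex n ds) (k ^ m))) length-ds ⟩
      concat (applyUpTo (vertex n ds) (k ^ n))
    ≡⟨ cong concat (applyUpTo-cong-< (k ^ n) vertex≡[σ]) ⟩
      concat (applyUpTo ([_] ∘ σ) (k ^ n))
    ≡⟨ cong concat (map-applyUpTo σ [_] (k ^ n)) ⟨
      concat (map [_] (applyUpTo σ (k ^ n)))
    ≡⟨ concat-map-[ applyUpTo σ (k ^ n) ] ⟩
      applyUpTo σ (k ^ n) ∎
    where
    open ≡-Reasoning
    f : Fin n → ℕ
    f i = toℕ (w ⟨$⟩ʳ i)
    fire : Layer → Fin n → Layer
    fire L i = fireLayer k n (f i) L
    ds = foldl (push n f) [] (allFin n)
    σ = permuteDigits (w ⟨$⟩ˡ_)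
    length-ds : length ds ≡ n
    length-ds = trans (length-foldl-push n f [] (allFin n)) (trans (+-identityʳ _) (length-tabulate id))
    address-ds : ∀ c → address n ds c ≡ permuteDigits (w ⟨$⟩ʳ_) c
    address-ds c = trans (address-foldl-push n f [] (allFin n) c)
                         (foldl-horner-tabulate (λ i → digit k n (f i) c) id 0)
    vertex≡[σ] : ∀ {q} → q < k ^ n → vertex n ds q ≡ [ σ q ]
    vertex≡[σ] {q} q<k^n = filter-fibre-upTo (address n ds) σ
      (λ c<k^n → trans (cong σ (address-ds _))
                       (permuteDigits-inverse (w ⟨$⟩ˡ_) (w ⟨$⟩ʳ_) (λ _ → inverseʳ w) c<k^n))
      (permuteDigits-< (w ⟨$⟩ˡ_) q)
      (trans (address-ds (σ q))
             (permuteDigits-inverse (w ⟨$⟩ʳ_) (w ⟨$⟩ˡ_) (λ _ → inverseˡ w) q<k^n))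

  onesExcept-< : 2 ≤ k → ∀ {n} (d j : Fin n) → onesExcept d j < k
  onesExcept-< 2≤k d j with does (j F.≟ d)
  ... | true  = z<s
  ... | false = 2≤k

  fromDigits-onesExcept-mono : 2 ≤ k → ∀ {n} {d d′ : Fin n} → d F.< d′ →
                               fromDigits (onesExcept d) < fromDigits (onesExcept d′)
  fromDigits-onesExcept-mono 2≤k {d = d} {d′} d<d′ =
    fromDigits-<-lex (onesExcept-< 2≤k d) d
      (λ j j<d → trans (onesExcept-≢ (FP.<⇒≢ j<d))
                       (sym (onesExcept-≢ (FP.<⇒≢ (FP.<-trans j<d d<d′)))))
      (subst₂ _<_ (sym (onesExcept-self d)) (sym (onesExcept-≢ (FP.<⇒≢ d<d′))) z<s)

  applyUpTo-permuteDigits-containsPattern : 2 ≤ k → ∀ n (w : Permutation′ n) →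
    applyUpTo (permuteDigits (w ⟨$⟩ˡ_)) (k ^ n) containsPattern w
  applyUpTo-permuteDigits-containsPattern 2≤k n w =
    applyUpTo-containsPattern w (permuteDigits (w ⟨$⟩ˡ_)) (fromDigits ∘ onesExcept)
      (fromDigits-onesExcept-mono 2≤k)
      (λ a → fromDigits-< (onesExcept-< 2≤k a))
      (λ a → trans (permuteDigits-fromDigits (w ⟨$⟩ˡ_) (onesExcept-< 2≤k a))
                   (fromDigits-cong (onesExcept-permute w a)))

proposition3p11 : (k n : ℕ) → 2 ≤ k → 1 ≤ n → (w : Permutation′ n) →
    Σ (Fin n → Fin (length (stableConfig k n w))) (λ p →
      (∀ (a b : Fin n) → a F.< b → p a F.< p b) ×
      (∀ (a b : Fin n) →
        (lookup (stableConfig k n w) (p a) < lookup (stableConfig k n w) (p b)) ⇔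
        ((w ⟨$⟩ʳ a) F.< (w ⟨$⟩ʳ b))))
proposition3p11 zero     n ()  _ w
proposition3p11 (suc k′) n 2≤k _ w =
  subst (_containsPattern w) (sym (stableConfig≡applyUpTo-permuteDigits k′ n w))
    (applyUpTo-permuteDigits-containsPattern k′ 2≤k n w)
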